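{- Let $p$ be an ultrafilter on $\omega$. Then $\mathscr G^p$ is closed under ultrafilter limits: if $u\in\mathscr G^p$ and $u_n\in\mathscr G^p$ for all $n<\omega$, then $u\text{ - }\lim_n u_n\in\mathscr G^p$.
   Context: For ultrafilters $u,u_n$ on $\omega$, $u\text{ - }\lim_n u_n=\{A\subseteq\omega : \{n : A\in u_n\}\in u\}$. For $p\in\beta\omega$ define $\mathscr G^p_1$ = the set of principal ultrafilters on $\omega$, $\mathscr G^p_{\alpha+1}=\{p\text{ - }\lim_n u_n : u_n\in\mathscr G^p_\alpha\text{ for all } n\}$, $\mathscr G^p_\alpha=\bigcup_{\xi<\alpha}\mathscr G^p_\xi$ for limit $\alpha$, and $\mathscr G^p=\bigcup_{\alpha\ge1}\mathscr G^p_\alpha$. -}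

module Defs where

open import Data.Nat using (ℕ)
open import Data.Bool using (Bool; true; false; _∧_; not)
open import Data.Product using (Σ; ∃; _×_; _,_)
open import Data.Sum using (_⊎_)
open import Relation.Binary.PropositionalEquality using (_≡_)

Subset : Set
Subset = ℕ → Bool

_∈ˢ_ : ℕ → Subset → Set
n ∈ˢ A = A n ≡ true

_⊆ˢ_ : Subset → Subset → Set
A ⊆ˢ B = ∀ n → n ∈ˢ A → n ∈ˢ B

_∩ˢ_ : Subset → Subset → Subset
(A ∩ˢ B) n = A n ∧ B n

∁ˢ : Subset → Subset
∁ˢ A n = not (A n)

fullˢ : Subset
fullˢ _ = true

emptyˢ : Subset
emptyˢ _ = false

record Ultrafilter : Set where
  field
    mem    : Subset → Bool
    full∈  : mem fullˢ ≡ true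
    empty∉ : mem emptyˢ ≡ false
    upward : ∀ A B → A ⊆ˢ B → mem A ≡ true → mem B ≡ true
    inter  : ∀ A B → mem A ≡ true → mem B ≡ true → mem (A ∩ˢ B) ≡ true
    ultra  : ∀ A → mem A ≡ true ⊎ mem (∁ˢ A) ≡ true

open Ultrafilter public

_∈ᵘ_ : Subset → Ultrafilter → Set
A ∈ᵘ U = mem U A ≡ true

IsPrincipal : Ultrafilter → Set
IsPrincipal v = ∃ λ k → ∀ A → mem v A ≡ A k

IsULim : Ultrafilter → (ℕ → Ultrafilter) → Ultrafilter → Set
IsULim u us v = ∀ A → mem v A ≡ mem u (λ n → mem (us n) A)

-- Ordinal indices α ≥ 1 as Brouwer trees (countable ordinals):
-- one = 1, suc α = α + 1, lim f = sup of the sequence f.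
data Ord : Set where
  one : Ord
  suc : Ord → Ord
  lim : (ℕ → Ord) → Ord

𝒢 : Ultrafilter → Ord → Ultrafilter → Set
𝒢 p one     v = IsPrincipal v
𝒢 p (suc α) v = Σ (ℕ → Ultrafilter) λ us → (∀ n → 𝒢 p α (us n)) × IsULim p us v
𝒢 p (lim f) v = ∃ λ n → 𝒢 p (f n) v

_∈𝒢[_] : Ultrafilter → Ultrafilter → Set
v ∈𝒢[ p ] = ∃ λ α → 𝒢 p α v

{-# OPTIONS --safe #-}
-- Induction on the rank of u.  If u is principal at k then u-lim us = us k.
-- If u = p-lim w_m then limits associate: u-lim us = p-lim_m (w_m-lim us),
-- each w_m-lim us lies in 𝒢^p by induction, and 𝒢^p is closed under p-limits
-- of sequences, since the supremum of countably many ranks is again a rank.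
module Submission where

open import Defs
open import Data.Nat using (ℕ)
open import Data.Product using (Σ; _×_; _,_; proj₁; proj₂)
open import Data.Sum using (inj₁; inj₂; map₂)
open import Data.Bool using (true; false; _∧_)
open import Data.Bool.Properties using (⇔→≡; not-injective)
open import Function using (_∘_)
open import Function.Bundles using (mk⇔)
open import Relation.Nullary using (contradiction)
open import Relation.Binary.PropositionalEquality using (_≡_; refl; sym; trans; _≗_)

∧≡true⇒× : ∀ {a b} → a ∧ b ≡ true → a ≡ true × b ≡ true
∧≡true⇒× {true} b≡true = refl , b≡true

module _ (U : Ultrafilter) where

  mem-cong : ∀ {A B} → A ≗ B → mem U A ≡ mem U B
  mem-cong A≗B = ⇔→≡ (mk⇔ (upward U _ _ λ n → trans (sym (A≗B n)))
                          (upward U _ _ λ n → trans (A≗B n)))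

  mem-empty : ∀ {A} → A ≗ emptyˢ → mem U A ≡ false
  mem-empty A≗∅ = trans (mem-cong A≗∅) (empty∉ U)

  ∉⇒∁∈ : ∀ A → mem U A ≡ false → ∁ˢ A ∈ᵘ U
  ∉⇒∁∈ A A∉ with ultra U A
  ... | inj₁ A∈  = contradiction (trans (sym A∈) A∉) λ ()
  ... | inj₂ ∁A∈ = ∁A∈

ulim : Ultrafilter → (ℕ → Ultrafilter) → Ultrafilter
ulim u us = record
  { mem    = λ A → mem u (λ n → mem (us n) A)
  ; full∈  = upward u fullˢ _ (λ n _ → full∈ (us n)) (full∈ u)
  ; empty∉ = mem-empty u (λ n → empty∉ (us n))
  ; upward = λ A B A⊆B → upward u _ _ λ n → upward (us n) A B A⊆B
  ; inter  = λ A B A∈ B∈ → upward u _ _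
               (λ n A∩B∈ → let A∈ₙ , B∈ₙ = ∧≡true⇒× A∩B∈ in inter (us n) A B A∈ₙ B∈ₙ)
               (inter u _ _ A∈ B∈)
  ; ultra  = λ A → map₂ (upward u _ _ λ n → ∉⇒∁∈ (us n) A ∘ not-injective) (ultra u _)
  }

ulim-isULim : ∀ u us → IsULim u us (ulim u us)
ulim-isULim u us A = refl

ulim-principal : ∀ u us k → (∀ A → mem u A ≡ A k) → mem (us k) ≗ mem (ulim u us)
ulim-principal u us k u≡k A = sym (u≡k _)

ulim-assoc : ∀ p ws u us → IsULim p ws u → IsULim p (λ m → ulim (ws m) us) (ulim u us)
ulim-assoc p ws u us u≡lim A = u≡lim _

module _ (p : Ultrafilter) where

  𝒢-resp : ∀ α {v w} → mem v ≗ mem w → 𝒢 p α v → 𝒢 p α w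
  𝒢-resp one     v≡w (k , v≡k)         = k , λ A → trans (sym (v≡w A)) (v≡k A)
  𝒢-resp (suc α) v≡w (ws , ws∈ , v≡lim) = ws , ws∈ , λ A → trans (sym (v≡w A)) (v≡lim A)
  𝒢-resp (lim f) v≡w (n , v∈)          = n , 𝒢-resp (f n) v≡w v∈

  plim-∈𝒢 : ∀ ws {v} → (∀ m → ws m ∈𝒢[ p ]) → IsULim p ws v → v ∈𝒢[ p ]
  plim-∈𝒢 ws ws∈ v≡lim = suc (lim (proj₁ ∘ ws∈)) , ws , (λ m → m , proj₂ (ws∈ m)) , v≡lim

  ulim-∈𝒢 : ∀ α u us → 𝒢 p α u → (∀ n → us n ∈𝒢[ p ]) → ulim u us ∈𝒢[ p ]
  ulim-∈𝒢 one     u us (k , u≡k) us∈ =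
    let β , usₖ∈ = us∈ k in β , 𝒢-resp β (ulim-principal u us k u≡k) usₖ∈
  ulim-∈𝒢 (suc α) u us (ws , ws∈ , u≡lim) us∈ =
    plim-∈𝒢 (λ m → ulim (ws m) us)
      (λ m → ulim-∈𝒢 α (ws m) us (ws∈ m) us∈)
      (ulim-assoc p ws u us u≡lim)
  ulim-∈𝒢 (lim f) u us (n , u∈) us∈ = ulim-∈𝒢 (f n) u us u∈ us∈

theorem3p11 : (p u : Ultrafilter) (us : ℕ → Ultrafilter) →
    u ∈𝒢[ p ] → (∀ n → us n ∈𝒢[ p ]) →
    Σ Ultrafilter (λ v → v ∈𝒢[ p ] × IsULim u us v)
theorem3p11 p u us (α , u∈) us∈ = ulim u us , ulim-∈𝒢 p α u us u∈ us∈ , ulim-isULim u us
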